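{- Let $\mathcal{A}$ be a finite group. Then $$\Psi_{\mathcal{A}}^w(x)=\frac{1}{|\mathrm{Aut}(\mathcal{A})|}\sum_{\alpha\in\mathrm{Aut}(\mathcal{A})}\left(\sum_{K\le\mathcal{A}}\mu(K)\left(\sum_{\Omega\in S(K),\ \alpha(\Omega)=\Omega}x^{|\Omega|}\right)\right)$$ and $$\Psi_{\mathcal{A}}(x)=\frac{1}{|\mathrm{Inn}(\mathcal{A})|}\sum_{\alpha\in\mathrm{Inn}(\mathcal{A})}\left(\sum_{K\le\mathcal{A}}\mu(K)\left(\sum_{\Omega\in S(K),\ \alpha(\Omega)=\Omega}x^{|\Omega|}\right)\right).$$
   Context: For a finite group $\mathcal{A}$ with identity $e$ and a generating set $\Omega$ with $\Omega=\Omega^{ -1}$, $e\notin\Omega$, the Cayley graph $C(\mathcal{A},\Omega)$ has vertex set $\mathcal{A}$ and edges $\{g,h\}$ with $g^{ -1}h\in\Omega$, with $\mathcal{A}$ acting by left multiplication. A graph isomorphism $f$ between two such Cayley graphs is a weak equivalence if there is $\alpha\in\mathrm{Aut}(\mathcal{A})$ with $f(gu)=\alpha(g)f(u)$ for all $g,u$, and an equivalence if this holds with $\alpha$ the identity. $a_k^w(\mathcal{A})$ (resp. $a_k(\mathcal{A})$) is the number of weak equivalence (resp. equivalence) classes of Cayley graphs $C(\mathcal{A},\Omega)$ with $|\Omega|=k$; $\Psi^w_{\mathcal{A}}(x)=\sum_{k=1}^{|\mathcal{A}|-1}a_k^w(\mathcal{A})x^k$, $\Psi_{\mathcal{A}}(x)=\sum_{k=1}^{|\mathcal{A}|-1}a_k(\mathcal{A})x^k$.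 For a subgroup $K$, $S(K)=\{\Omega\subseteq K:\Omega=\Omega^{ -1},\ e\notin\Omega\}$. The Möbius function $\mu$ on subgroups of $\mathcal{A}$ is defined recursively by $\sum_{H\ge K}\mu(H)=1$ if $K=\mathcal{A}$ and $0$ if $K<\mathcal{A}$ (sum over subgroups $H\supseteq K$). $K$ runs over all subgroups of $\mathcal{A}$. -}

module Defs where

open import Data.Nat using (ℕ; zero; suc; _≤_; _<_)
open import Data.Bool using (Bool; true; false; if_then_else_)
import Data.Bool.Properties as BoolP
open import Data.Fin using (Fin) renaming (_≟_ to _≟ᶠ_)
open import Data.Fin.Properties using (all?; any?)
open import Data.Fin.Subset using (Subset; _∈_; _∉_; _⊆_; ⊤; ∣_∣)
open import Data.Fin.Subset.Properties using (_∈?_; _⊆?_)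
open import Data.Integer using (ℤ; +_; _+_; _*_)
open import Data.List using (List; []; _∷_; map; concatMap; filter; foldr; length)
import Data.List as L
open import Data.List.Relation.Unary.All using (All)
open import Data.Vec using (Vec; []; _∷_; lookup; tabulate)
import Data.Vec.Properties as VecP
open import Data.Product using (Σ; ∃; _×_; _,_; proj₁; proj₂)
open import Function.Definitions using (Bijective)
open import Relation.Binary.PropositionalEquality using (_≡_; refl)
open import Relation.Nullary using (Dec; ¬_)
open import Relation.Nullary.Decidable using (_×-dec_; _→-dec_; ¬?; ⌊_⌋; map′)
open import Algebra.Structures using (IsGroup)

record FinGroup (n : ℕ) : Set where
  infixl 7 _∙_
  field
    _∙_     : Fin n → Fin n → Fin n
    ε       : Fin n
    _⁻¹     : Fin n → Fin n
    isGroup : IsGroup _≡_ _∙_ ε _⁻¹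

sumℤ : List ℤ → ℤ
sumℤ = foldr _+_ (+ 0)

allSubsets : (m : ℕ) → List (Subset m)
allSubsets zero    = [] ∷ []
allSubsets (suc m) =
  concatMap (λ b → map (b ∷_) (allSubsets m)) (true ∷ false ∷ [])

allVecs : (n m : ℕ) → List (Vec (Fin n) m)
allVecs n zero    = [] ∷ []
allVecs n (suc m) =
  concatMap (λ x → map (x ∷_) (allVecs n m)) (L.allFin n)

-- Number of equivalence classes: "ClassCount P R m" says that the elements
-- satisfying P fall into exactly m classes of the relation R, witnessed by
-- m representatives that are pairwise R-inequivalent and such that every
-- element satisfying P is R-related to one of them.
ClassCount : {A : Set} → (P : A → Set) → (R : A → A → Set) → ℕ → Set
ClassCount {A} P R m =
  Σ (Vec A m) λ reps →
    (∀ i → P (lookup reps i)) ×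
    (∀ i j → R (lookup reps i) (lookup reps j) → i ≡ j) ×
    (∀ x → P x → ∃ λ i → R x (lookup reps i))

module _ {n : ℕ} (G : FinGroup n) where
  open FinGroup G

  IsAutomorphism : (Fin n → Fin n) → Set
  IsAutomorphism α = Bijective _≡_ _≡_ α × (∀ x y → α (x ∙ y) ≡ α x ∙ α y)

  IsSymmetric : Subset n → Set
  IsSymmetric Ω = ∀ x → x ∈ Ω → (x ⁻¹) ∈ Ω

  -- Ω generates the group: every element is a finite product of elements of Ω
  -- (for symmetric Ω this is the subgroup generated by Ω)
  Generates : Subset n → Set
  Generates Ω = ∀ g → ∃ λ (l : List (Fin n)) → All (_∈ Ω) l × foldr _∙_ ε l ≡ g

  IsConnectionSet : ℕ → Subset n → Set
  IsConnectionSet k Ω = IsSymmetric Ω × ε ∉ Ω × Generates Ω × ∣ Ω ∣ ≡ k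

  Adj : Subset n → Fin n → Fin n → Set
  Adj Ω g h = ((g ⁻¹) ∙ h) ∈ Ω

  IsCayleyIso : Subset n → Subset n → (Fin n → Fin n) → Set
  IsCayleyIso Ω Ω' f =
    Bijective _≡_ _≡_ f ×
    (∀ g h → (Adj Ω g h → Adj Ω' (f g) (f h)) × (Adj Ω' (f g) (f h) → Adj Ω g h))

  WeaklyEquivalent : Subset n → Subset n → Set
  WeaklyEquivalent Ω Ω' =
    ∃ λ (f : Fin n → Fin n) → IsCayleyIso Ω Ω' f ×
      ∃ λ (α : Fin n → Fin n) → IsAutomorphism α × (∀ g u → f (g ∙ u) ≡ α g ∙ f u)

  Equivalent : Subset n → Subset n → Set
  Equivalent Ω Ω' =
    ∃ λ (f : Fin n → Fin n) → IsCayleyIso Ω Ω' f × (∀ g u → f (g ∙ u) ≡ g ∙ f u)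

  -- a map Fin n → Fin n represented by its table
  Map : Set
  Map = Vec (Fin n) n

  app : Map → Fin n → Fin n
  app = lookup

  isAutomorphism? : (α : Map) → Dec (IsAutomorphism (app α))
  isAutomorphism? α =
    ((map′ (λ h {x} {y} → h x y) (λ h x y → h {x} {y})
        (all? λ x → all? λ y → (app α x ≟ᶠ app α y) →-dec (x ≟ᶠ y)))
      ×-dec map′ (λ h y → proj₁ (h y) , λ { refl → proj₂ (h y) })
                 (λ h y → proj₁ (h y) , proj₂ (h y) refl)
                 (all? λ y → any? λ x → app α x ≟ᶠ y))
    ×-dec (all? λ x → all? λ y → app α (x ∙ y) ≟ᶠ app α x ∙ app α y)

  autList : List Map
  autList = filter isAutomorphism? (allVecs n n)

  IsInner : Map → Set
  IsInner α = ∃ λ g → ∀ x → app α x ≡ (g ∙ x) ∙ (g ⁻¹)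

  isInner? : (α : Map) → Dec (IsInner α)
  isInner? α = any? λ g → all? λ x → app α x ≟ᶠ (g ∙ x) ∙ (g ⁻¹)

  innList : List Map
  innList = filter isInner? autList

  IsSubgroup : Subset n → Set
  IsSubgroup K = ε ∈ K × (∀ x y → x ∈ K → y ∈ K → (x ∙ y) ∈ K) × (∀ x → x ∈ K → (x ⁻¹) ∈ K)

  isSubgroup? : (K : Subset n) → Dec (IsSubgroup K)
  isSubgroup? K =
    (ε ∈? K)
    ×-dec (all? λ x → all? λ y → (x ∈? K) →-dec ((y ∈? K) →-dec ((x ∙ y) ∈? K)))
    ×-dec (all? λ x → (x ∈? K) →-dec ((x ⁻¹) ∈? K))

  subgroupList : List (Subset n)
  subgroupList = filter isSubgroup? (allSubsets n)

  -- μ is the Möbius function on the subgroup lattice: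
  -- for every subgroup K, Σ_{H ≥ K} μ(H) = 1 if K = A and 0 otherwise
  IsMobius : (Subset n → ℤ) → Set
  IsMobius μ =
    ∀ K → IsSubgroup K →
      sumℤ (map μ (filter (K ⊆?_) subgroupList))
        ≡ (if ⌊ VecP.≡-dec BoolP._≟_ K ⊤ ⌋ then + 1 else + 0)

  image : Map → Subset n → Subset n
  image α Ω = tabulate λ y → ⌊ any? (λ x → (x ∈? Ω) ×-dec (app α x ≟ᶠ y)) ⌋

  FixedInS : Map → Subset n → ℕ → Subset n → Set
  FixedInS α K k Ω =
    Ω ⊆ K × IsSymmetric Ω × ε ∉ Ω × image α Ω ≡ Ω × ∣ Ω ∣ ≡ k

  fixedInS? : (α : Map) (K : Subset n) (k : ℕ) (Ω : Subset n) → Dec (FixedInS α K k Ω)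
  fixedInS? α K k Ω =
    (Ω ⊆? K)
    ×-dec (all? λ x → (x ∈? Ω) →-dec ((x ⁻¹) ∈? Ω))
    ×-dec ¬? (ε ∈? Ω)
    ×-dec VecP.≡-dec BoolP._≟_ (image α Ω) Ω
    ×-dec (∣ Ω ∣ Data.Nat.≟ k)

  -- coefficient of x^k in  Σ_{K ≤ A} μ(K) Σ_{Ω ∈ S(K), α(Ω)=Ω} x^{|Ω|}
  innerCoeff : (Subset n → ℤ) → Map → ℕ → ℤ
  innerCoeff μ α k =
    sumℤ (map (λ K → μ K * + length (filter (fixedInS? α K k) (allSubsets n))) subgroupList)

  sumCoeff : (Subset n → ℤ) → List Map → ℕ → ℤ
  sumCoeff μ L k = sumℤ (map (λ α → innerCoeff μ α k) L)

  -- The identity  Ψ(x) = (1/|L|) Σ_{α∈L} (…)  compared coefficientwise and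
  -- multiplied by |L|, where the coefficient of x^k in Ψ is the number a_k of
  -- R-classes of connection sets of size k for 1 ≤ k ≤ |A|-1, and 0 otherwise.
  FormulaHolds : (Subset n → ℤ) → (Subset n → Subset n → Set) → List Map → Set
  FormulaHolds μ R L =
    (∀ k → 1 ≤ k → k < n → ∀ a → ClassCount (IsConnectionSet k) R a →
       + length L * + a ≡ sumCoeff μ L k)
    × (∀ k → (k ≡ 0 → sumCoeff μ L k ≡ + 0) × (n ≤ k → sumCoeff μ L k ≡ + 0))

module Submission where

-- Möbius inversion on the subgroup lattice: for symmetric Ω, the sum of μ(K) over the
-- subgroups K ⊇ Ω is 1 if Ω generates the group and 0 otherwise, so the inner sum of the
-- formula counts the α-fixed connection sets of size k. Two connection sets give
-- weakly equivalent (resp. equivalent) Cayley graphs exactly when an automorphism (resp.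
-- an inner automorphism) maps one onto the other, so a_k is the number of orbits of
-- Aut(A) (resp. Inn(A)) on connection sets of size k, and Burnside's lemma finishes.

open import Defs
open import Algebra.Bundles using (Group)
open import Data.Bool using (true; false; if_then_else_)
open import Data.Bool.Properties using (T-≡)
import Data.Bool.Properties as Bool
open import Data.Fin using (Fin; zero; suc; punchIn)
import Data.Fin.Properties as Fin
open import Data.Fin.Subset
  using (Subset; _∈_; _∉_; _⊆_; _⊂_; ⊤; ⁅_⁆; _∪_; ∣_∣; inside; outside)
open import Data.Fin.Subset.Properties
  using (_∈?_; _⊆?_; _⊂?_; ⊆-antisym; p⊂q⇒∣p∣<∣q∣; ∣p∣≤n; ∣⊤∣≡n; ⊆⊤; ∈⊤;
         x∈⁅x⁆; x∈⁅y⁆⇒x≡y; x∈p⇒∣p-x∣<∣p∣; p⊆p∪q; q⊆p∪q; x∈p∪q⁻; drop-there)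
open import Data.Integer using (ℤ; +_; _+_; _*_)
import Data.Integer.Properties as ℤ
open import Data.Integer.Tactic.RingSolver using (solve-∀)
open import Data.List using (List; []; _∷_; _++_; map; concatMap; filter; length; foldr; allFin)
import Data.List.Properties as List
open import Data.List.Relation.Unary.All using (All; []; _∷_)
import Data.List.Relation.Unary.All.Properties as All
open import Data.Nat using (ℕ; zero; suc; _≤_; _<_; s≤s; z≤n)
import Data.Nat.Properties as ℕ
open import Data.Nat.GeneralisedArithmetic using (fold)
open import Data.Product using (∃; _×_; _,_; proj₁; proj₂)
open import Data.Sum using (_⊎_; inj₁; inj₂)
open import Data.Vec using (Vec; []; _∷_; lookup; tabulate; there)
import Data.Vec.Properties as Vec
open import Function using (_∘_; id; _⇔_; mk⇔; Equivalence)
open import Function.Definitions using (Bijective)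
open import Level using (0ℓ)
open import Relation.Binary.Definitions using (DecidableEquality)
open import Relation.Binary.PropositionalEquality
open import Relation.Nullary using (Dec; yes; no; ¬_; contradiction)
open import Relation.Nullary.Decidable
  using (⌊_⌋; _×-dec_; _→-dec_; ¬?; toWitness; fromWitness; decidable-stable)
import Relation.Nullary.Decidable as Dec
open import Relation.Unary using (Decidable)
open ≡-Reasoning

∑ : {A : Set} → List A → (A → ℤ) → ℤ
∑ xs f = sumℤ (map f xs)

infix 5 ∑
syntax ∑ xs (λ x → e) = ∑[ x ∈ xs ] e

𝟙 : {P : Set} → Dec P → ℤ
𝟙 d = if ⌊ d ⌋ then + 1 else + 0

module _ {A : Set} where

  ∑-cong : (xs : List A) {f g : A → ℤ} → (∀ x → f x ≡ g x) → ∑ xs f ≡ ∑ xs g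
  ∑-cong []       f≗g = refl
  ∑-cong (x ∷ xs) f≗g = cong₂ _+_ (f≗g x) (∑-cong xs f≗g)

  ∑-++ : (xs ys : List A) (f : A → ℤ) → ∑ (xs ++ ys) f ≡ ∑ xs f + ∑ ys f
  ∑-++ []       ys f = sym (ℤ.+-identityˡ _)
  ∑-++ (x ∷ xs) ys f = trans (cong (_+_ (f x)) (∑-++ xs ys f)) (sym (ℤ.+-assoc (f x) _ _))

  ∑-+ : (xs : List A) (f g : A → ℤ) → ∑[ x ∈ xs ] (f x + g x) ≡ ∑ xs f + ∑ xs g
  ∑-+ []       f g = refl
  ∑-+ (x ∷ xs) f g =
    trans (cong (_+_ (f x + g x)) (∑-+ xs f g)) (interchange (f x) (g x) (∑ xs f) (∑ xs g))
    where
    interchange : ∀ a b c d → (a + b) + (c + d) ≡ (a + c) + (b + d)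
    interchange = solve-∀

  *-distribˡ-∑ : (xs : List A) (c : ℤ) (f : A → ℤ) → c * ∑ xs f ≡ ∑[ x ∈ xs ] c * f x
  *-distribˡ-∑ []       c f = ℤ.*-zeroʳ c
  *-distribˡ-∑ (x ∷ xs) c f =
    trans (ℤ.*-distribˡ-+ c (f x) _) (cong (_+_ (c * f x)) (*-distribˡ-∑ xs c f))

  ∑-zero : (xs : List A) {f : A → ℤ} → (∀ x → f x ≡ + 0) → ∑ xs f ≡ + 0
  ∑-zero []       f≗0 = refl
  ∑-zero (x ∷ xs) f≗0 = cong₂ _+_ (f≗0 x) (∑-zero xs f≗0)

  ∑-const : (xs : List A) (c : ℤ) → ∑[ x ∈ xs ] c ≡ c * + length xs
  ∑-const []       c = sym (ℤ.*-zeroʳ c)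
  ∑-const (x ∷ xs) c = trans (cong (_+_ c) (∑-const xs c)) (sym (ℤ.*-suc c (+ length xs)))

  ∑-filter : {P : A → Set} (P? : Decidable P) (xs : List A) (f : A → ℤ) →
             ∑ (filter P? xs) f ≡ ∑[ x ∈ xs ] 𝟙 (P? x) * f x
  ∑-filter P? []       f = refl
  ∑-filter P? (x ∷ xs) f with P? x
  ... | yes _ = cong₂ _+_ (sym (ℤ.*-identityˡ (f x))) (∑-filter P? xs f)
  ... | no  _ = trans (∑-filter P? xs f) (sym (ℤ.+-identityˡ _))

  ∑-filter-cong : {P : A → Set} (P? : Decidable P) (xs : List A) {f g : A → ℤ} →
                  (∀ x → P x → f x ≡ g x) → ∑ (filter P? xs) f ≡ ∑ (filter P? xs) g
  ∑-filter-cong P? []       f≗g = refl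
  ∑-filter-cong P? (x ∷ xs) f≗g with P? x
  ... | yes px = cong₂ _+_ (f≗g x px) (∑-filter-cong P? xs f≗g)
  ... | no  _  = ∑-filter-cong P? xs f≗g

  length-filter : {P : A → Set} (P? : Decidable P) (xs : List A) →
                  + length (filter P? xs) ≡ ∑[ x ∈ xs ] 𝟙 (P? x)
  length-filter P? []       = refl
  length-filter P? (x ∷ xs) with P? x
  ... | yes _ = cong (_+_ (+ 1)) (length-filter P? xs)
  ... | no  _ = trans (length-filter P? xs) (sym (ℤ.+-identityˡ _))

module _ {A B : Set} where

  ∑-map : (h : A → B) (xs : List A) (f : B → ℤ) → ∑ (map h xs) f ≡ ∑[ x ∈ xs ] f (h x)
  ∑-map h []       f = refl
  ∑-map h (x ∷ xs) f = cong (_+_ (f (h x))) (∑-map h xs f)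

  ∑-concatMap : (h : A → List B) (xs : List A) (f : B → ℤ) →
                ∑ (concatMap h xs) f ≡ ∑[ x ∈ xs ] ∑ (h x) f
  ∑-concatMap h []       f = refl
  ∑-concatMap h (x ∷ xs) f =
    trans (∑-++ (h x) (concatMap h xs) f) (cong (_+_ (∑ (h x) f)) (∑-concatMap h xs f))

  ∑-comm : (xs : List A) (ys : List B) (f : A → B → ℤ) →
           ∑[ x ∈ xs ] ∑ ys (f x) ≡ ∑[ y ∈ ys ] ∑[ x ∈ xs ] f x y
  ∑-comm []       ys f = sym (∑-zero ys (λ _ → refl))
  ∑-comm (x ∷ xs) ys f =
    trans (cong (_+_ (∑ ys (f x))) (∑-comm xs ys f)) (sym (∑-+ ys (f x) _))

module _ {P Q : Set} where

  𝟙-× : (p : Dec P) (q : Dec Q) → 𝟙 (p ×-dec q) ≡ 𝟙 p * 𝟙 q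
  𝟙-× (yes _) (yes _) = refl
  𝟙-× (yes _) (no  _) = refl
  𝟙-× (no  _) (yes _) = refl
  𝟙-× (no  _) (no  _) = refl

  𝟙-⇔ : (p : Dec P) (q : Dec Q) → P ⇔ Q → 𝟙 p ≡ 𝟙 q
  𝟙-⇔ (yes _)  (yes _)  P⇔Q = refl
  𝟙-⇔ (yes p)  (no ¬q)  P⇔Q = contradiction (Equivalence.to P⇔Q p) ¬q
  𝟙-⇔ (no  ¬p) (yes q)  P⇔Q = contradiction (Equivalence.from P⇔Q q) ¬p
  𝟙-⇔ (no  _)  (no  _)  P⇔Q = refl

module _ {P : Set} where

  𝟙-yes : (p : Dec P) → P → 𝟙 p ≡ + 1
  𝟙-yes (yes _) _  = refl
  𝟙-yes (no ¬p) p = contradiction p ¬p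

  𝟙-no : (p : Dec P) → ¬ P → 𝟙 p ≡ + 0
  𝟙-no (yes p) ¬p = contradiction p ¬p
  𝟙-no (no _)  _  = refl

-- Equivalent to xs listing every element of A exactly once.
record IsEnumeration {A : Set} (_≟_ : DecidableEquality A) (xs : List A) : Set where
  field
    ∑-pick : ∀ x (f : A → ℤ) → ∑[ y ∈ xs ] 𝟙 (x ≟ y) * f y ≡ f x

open IsEnumeration

module _ {A : Set} {_≟_ : DecidableEquality A} {xs : List A}
         (enum : IsEnumeration _≟_ xs) where

  private
    pick = ∑-pick enum

  ∑-reindex : (h h⁻¹ : A → A) → (∀ x → h (h⁻¹ x) ≡ x) → (∀ y → h⁻¹ (h y) ≡ y) →
              (f : A → ℤ) → ∑[ y ∈ xs ] f (h y) ≡ ∑ xs f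
  ∑-reindex h h⁻¹ hh⁻¹ h⁻¹h f = begin
    ∑[ y ∈ xs ] f (h y)                          ≡⟨ ∑-cong xs (λ y → sym (pick (h y) f)) ⟩
    ∑[ y ∈ xs ] ∑[ x ∈ xs ] 𝟙 (h y ≟ x) * f x    ≡⟨ ∑-comm xs xs _ ⟩
    ∑[ x ∈ xs ] ∑[ y ∈ xs ] 𝟙 (h y ≟ x) * f x    ≡⟨ ∑-cong xs (λ x → ∑-cong xs (λ y → cong (_* f x)
                                                     (𝟙-⇔ (h y ≟ x) (h⁻¹ x ≟ y) (h-graph x y)))) ⟩
    ∑[ x ∈ xs ] ∑[ y ∈ xs ] 𝟙 (h⁻¹ x ≟ y) * f x  ≡⟨ ∑-cong xs (λ x → pick (h⁻¹ x) (λ _ → f x)) ⟩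
    ∑ xs f                                       ∎
    where
    h-graph : ∀ x y → h y ≡ x ⇔ h⁻¹ x ≡ y
    h-graph x y = mk⇔ (λ e → trans (cong h⁻¹ (sym e)) (h⁻¹h y))
                      (λ e → trans (cong h (sym e)) (hh⁻¹ x))

  ∑-indicator : ∀ x → ∑[ y ∈ xs ] 𝟙 (x ≟ y) ≡ + 1
  ∑-indicator x = trans (∑-cong xs (λ y → sym (ℤ.*-identityʳ _))) (pick x (λ _ → + 1))

∑-allFin-suc : ∀ m (g : Fin (suc m) → ℤ) →
               ∑ (allFin (suc m)) g ≡ g zero + (∑[ i ∈ allFin m ] g (suc i))
∑-allFin-suc m g =
  cong (λ l → g zero + sumℤ l) (trans (List.map-tabulate suc g) (sym (List.map-tabulate id (g ∘ suc))))

allFin-isEnumeration : ∀ m → IsEnumeration Fin._≟_ (allFin m)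
∑-pick (allFin-isEnumeration (suc m)) zero f =
  trans (∑-allFin-suc m (λ y → 𝟙 (zero Fin.≟ y) * f y))
        (trans (cong₂ _+_ (ℤ.*-identityˡ (f zero)) (∑-zero (allFin m) (λ _ → refl)))
               (ℤ.+-identityʳ _))
∑-pick (allFin-isEnumeration (suc m)) (suc x) f =
  trans (∑-allFin-suc m (λ y → 𝟙 (suc x Fin.≟ y) * f y))
        (trans (ℤ.+-identityˡ _)
               (trans (∑-cong (allFin m) (λ i → cong (_* f (suc i))
                        (𝟙-⇔ (suc x Fin.≟ suc i) (x Fin.≟ i) (mk⇔ Fin.suc-injective (cong suc)))))
                      (∑-pick (allFin-isEnumeration m) x (f ∘ suc))))

Bool-isEnumeration : IsEnumeration Bool._≟_ (true ∷ false ∷ [])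
∑-pick Bool-isEnumeration true  f = trans (ℤ.+-identityʳ _) (ℤ.*-identityˡ _)
∑-pick Bool-isEnumeration false f = trans (ℤ.+-identityˡ _) (trans (ℤ.+-identityʳ _) (ℤ.*-identityˡ _))

vectors : {A : Set} → List A → (m : ℕ) → List (Vec A m)
vectors as zero    = [] ∷ []
vectors as (suc m) = concatMap (λ x → map (x ∷_) (vectors as m)) as

module _ {A : Set} {_≟_ : DecidableEquality A} {as : List A}
         (enum : IsEnumeration _≟_ as) where

  private
    _≟ᵛ_ : ∀ {m} → DecidableEquality (Vec A m)
    _≟ᵛ_ = Vec.≡-dec _≟_

    𝟙-∷ : ∀ {m} x y (xs ys : Vec A m) → 𝟙 ((x ∷ xs) ≟ᵛ (y ∷ ys)) ≡ 𝟙 (x ≟ y) * 𝟙 (xs ≟ᵛ ys)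
    𝟙-∷ x y xs ys =
      trans (𝟙-⇔ ((x ∷ xs) ≟ᵛ (y ∷ ys)) ((x ≟ y) ×-dec (xs ≟ᵛ ys))
                 (mk⇔ Vec.∷-injective λ { (refl , refl) → refl }))
            (𝟙-× (x ≟ y) (xs ≟ᵛ ys))

  vectors-isEnumeration : ∀ m → IsEnumeration _≟ᵛ_ (vectors as m)
  ∑-pick (vectors-isEnumeration zero)    []       f = trans (ℤ.+-identityʳ _) (ℤ.*-identityˡ _)
  ∑-pick (vectors-isEnumeration (suc m)) (u ∷ us) f = begin
    ∑[ v ∈ vectors as (suc m) ] 𝟙 ((u ∷ us) ≟ᵛ v) * f v
      ≡⟨ ∑-concatMap _ as _ ⟩
    ∑[ x ∈ as ] ∑ (map (x ∷_) (vectors as m)) (λ v → 𝟙 ((u ∷ us) ≟ᵛ v) * f v)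
      ≡⟨ ∑-cong as (λ x → ∑-map (x ∷_) (vectors as m) _) ⟩
    ∑[ x ∈ as ] ∑[ v ∈ vectors as m ] 𝟙 ((u ∷ us) ≟ᵛ (x ∷ v)) * f (x ∷ v)
      ≡⟨ ∑-cong as (λ x → ∑-cong (vectors as m) (λ v →
           trans (cong (_* f (x ∷ v)) (𝟙-∷ u x us v)) (ℤ.*-assoc (𝟙 (u ≟ x)) _ _))) ⟩
    ∑[ x ∈ as ] ∑[ v ∈ vectors as m ] 𝟙 (u ≟ x) * (𝟙 (us ≟ᵛ v) * f (x ∷ v))
      ≡⟨ ∑-cong as (λ x → sym (*-distribˡ-∑ (vectors as m) (𝟙 (u ≟ x)) _)) ⟩
    ∑[ x ∈ as ] 𝟙 (u ≟ x) * (∑[ v ∈ vectors as m ] 𝟙 (us ≟ᵛ v) * f (x ∷ v))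
      ≡⟨ ∑-cong as (λ x → cong (𝟙 (u ≟ x) *_) (∑-pick (vectors-isEnumeration m) us (f ∘ (x ∷_)))) ⟩
    ∑[ x ∈ as ] 𝟙 (u ≟ x) * f (x ∷ us)
      ≡⟨ ∑-pick enum u (λ x → f (x ∷ us)) ⟩
    f (u ∷ us) ∎

allVecs-isEnumeration : ∀ n m → IsEnumeration (Vec.≡-dec Fin._≟_) (allVecs n m)
allVecs-isEnumeration n m =
  subst (IsEnumeration _) (sym (allVecs≡vectors m)) (vectors-isEnumeration (allFin-isEnumeration n) m)
  where
  allVecs≡vectors : ∀ m → allVecs n m ≡ vectors (allFin n) m
  allVecs≡vectors zero    = refl
  allVecs≡vectors (suc m) =
    cong (λ vs → concatMap (λ x → map (x ∷_) vs) (allFin n)) (allVecs≡vectors m)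

allSubsets-isEnumeration : ∀ m → IsEnumeration (Vec.≡-dec Bool._≟_) (allSubsets m)
allSubsets-isEnumeration m =
  subst (IsEnumeration _) (sym (allSubsets≡vectors m)) (vectors-isEnumeration Bool-isEnumeration m)
  where
  allSubsets≡vectors : ∀ m → allSubsets m ≡ vectors (true ∷ false ∷ []) m
  allSubsets≡vectors zero    = refl
  allSubsets≡vectors (suc m) =
    cong (λ ps → concatMap (λ b → map (b ∷_) ps) (true ∷ false ∷ [])) (allSubsets≡vectors m)

∈-tabulate : ∀ {m} {P : Fin m → Set} (P? : Decidable P) {y : Fin m} →
             y ∈ tabulate (λ z → ⌊ P? z ⌋) ⇔ P y
∈-tabulate P? {y} = mk⇔
  (λ y∈ → toWitness (Equivalence.from T-≡ (trans (sym (Vec.lookup∘tabulate _ y)) (Vec.[]=⇒lookup y∈))))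
  (λ Py → Vec.lookup⇒[]= y _ (trans (Vec.lookup∘tabulate _ y) (Equivalence.to T-≡ (fromWitness Py))))

∣p∣≡∑𝟙∈ : ∀ {m} (p : Subset m) → + ∣ p ∣ ≡ ∑[ x ∈ allFin m ] 𝟙 (x ∈? p)
∣p∣≡∑𝟙∈ []              = refl
∣p∣≡∑𝟙∈ {suc m} (b ∷ p) = begin
  + ∣ b ∷ p ∣                                            ≡⟨ head b ⟩
  𝟙 (zero ∈? b ∷ p) + + ∣ p ∣                            ≡⟨ cong (_+_ (𝟙 (zero ∈? b ∷ p))) (∣p∣≡∑𝟙∈ p) ⟩
  𝟙 (zero ∈? b ∷ p) + (∑[ x ∈ allFin m ] 𝟙 (x ∈? p))     ≡⟨ cong (_+_ (𝟙 (zero ∈? b ∷ p)))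
                                                              (∑-cong (allFin m) tail) ⟩
  𝟙 (zero ∈? b ∷ p) + (∑[ x ∈ allFin m ] 𝟙 (suc x ∈? b ∷ p)) ≡⟨ sym (∑-allFin-suc m (λ x → 𝟙 (x ∈? b ∷ p))) ⟩
  ∑[ x ∈ allFin (suc m) ] 𝟙 (x ∈? b ∷ p)                 ∎
  where
  head : ∀ b → + ∣ b ∷ p ∣ ≡ 𝟙 (zero ∈? b ∷ p) + + ∣ p ∣
  head inside  = refl
  head outside = sym (ℤ.+-identityˡ _)
  tail : ∀ x → 𝟙 (x ∈? p) ≡ 𝟙 (suc x ∈? b ∷ p)
  tail x = 𝟙-⇔ (x ∈? p) (suc x ∈? b ∷ p) (mk⇔ there drop-there)

other-element : ∀ {m} → 2 ≤ m → (x : Fin m) → ∃ λ y → y ≢ x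
other-element (s≤s (s≤s z≤n)) x = punchIn x zero , Fin.punchInᵢ≢i x zero

⊆⇒≡⊎⊂ : ∀ {m} {p q : Subset m} → p ⊆ q → p ≡ q ⊎ p ⊂ q
⊆⇒≡⊎⊂ {p = p} {q} p⊆q with p ⊂? q
... | yes p⊂q = inj₂ p⊂q
... | no  p⊄q = inj₁ (⊆-antisym p⊆q (λ {x} x∈q →
                  decidable-stable (x ∈? p) (λ x∉p → p⊄q (p⊆q , x , x∈q , x∉p))))

module _ {m : ℕ} (f : Subset m → Subset m) (inflationary : ∀ S → S ⊆ f S) (S : Subset m) where

  ⊆-fold : ∀ i → S ⊆ fold S f i
  ⊆-fold zero    x∈S = x∈S
  ⊆-fold (suc i) x∈S = inflationary _ (⊆-fold i x∈S)

  private
    stable-or-growing : ∀ i → f (fold S f i) ≡ fold S f i ⊎ i ≤ ∣ fold S f i ∣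
    stable-or-growing zero = inj₂ z≤n
    stable-or-growing (suc i) with stable-or-growing i
    ... | inj₁ fixed = inj₁ (cong f fixed)
    ... | inj₂ i≤∣Sᵢ∣ with ⊆⇒≡⊎⊂ (inflationary (fold S f i))
    ...   | inj₁ same  = inj₁ (cong f (sym same))
    ...   | inj₂ grows = inj₂ (ℕ.≤-trans (s≤s i≤∣Sᵢ∣) (p⊂q⇒∣p∣<∣q∣ grows))

  fold-fixedPoint : f (fold S f (suc m)) ≡ fold S f (suc m)
  fold-fixedPoint with stable-or-growing (suc m)
  ... | inj₁ fixed = fixed
  ... | inj₂ big   = contradiction (ℕ.≤-trans big (∣p∣≤n (fold S f (suc m)))) ℕ.1+n≰n

module _ {n : ℕ} (G : FinGroup n) where

  open FinGroup G

  private
    group : Group 0ℓ 0ℓ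
    group = record { isGroup = isGroup }

  open Group group using (assoc; identityˡ; identityʳ; inverseˡ; inverseʳ)
  open import Algebra.Properties.Group group
    using (ε⁻¹≈ε; ⁻¹-involutive; ⁻¹-anti-homo-∙; inverseˡ-unique; ∙-cancelˡ; ∙-cancelʳ)

  maps : List (Map G)
  maps = allVecs n n

  infixr 9 _⊙_
  _⊙_ : Map G → Map G → Map G
  α ⊙ β = tabulate (app G α ∘ app G β)

  app-tabulate : ∀ f x → app G (tabulate f) x ≡ f x
  app-tabulate = Vec.lookup∘tabulate

  app-⊙ : ∀ α β x → app G (α ⊙ β) x ≡ app G α (app G β x)
  app-⊙ α β = app-tabulate (app G α ∘ app G β)

  app-injective : ∀ {α β} → (∀ x → app G α x ≡ app G β x) → α ≡ β
  app-injective {α} {β} α≗β =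
    trans (sym (Vec.tabulate∘lookup α)) (trans (Vec.tabulate-cong α≗β) (Vec.tabulate∘lookup β))

  ⊙-cancelʳ : ∀ β γ → (∀ x → app G γ (app G β x) ≡ x) → ∀ α → (α ⊙ γ) ⊙ β ≡ α
  ⊙-cancelʳ β γ γβ≗id α = app-injective λ x → begin
    app G ((α ⊙ γ) ⊙ β) x         ≡⟨ app-⊙ (α ⊙ γ) β x ⟩
    app G (α ⊙ γ) (app G β x)     ≡⟨ app-⊙ α γ _ ⟩
    app G α (app G γ (app G β x)) ≡⟨ cong (app G α) (γβ≗id x) ⟩
    app G α x                     ∎

  mkAutomorphism : ∀ {a} → (∀ {x y} → a x ≡ a y → x ≡ y) → (∀ y → ∃ λ x → a x ≡ y) →
                   (∀ x y → a (x ∙ y) ≡ a x ∙ a y) → IsAutomorphism G a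
  mkAutomorphism inj surj hom = (inj , λ y → proj₁ (surj y) , λ { refl → proj₂ (surj y) }) , hom

  module _ {a : Fin n → Fin n} (A : IsAutomorphism G a) where

    aut-injective : ∀ {x y} → a x ≡ a y → x ≡ y
    aut-injective = proj₁ (proj₁ A)

    aut-∙ : ∀ x y → a (x ∙ y) ≡ a x ∙ a y
    aut-∙ = proj₂ A

    aut⁻¹ : Fin n → Fin n
    aut⁻¹ y = proj₁ (proj₂ (proj₁ A) y)

    aut-aut⁻¹ : ∀ y → a (aut⁻¹ y) ≡ y
    aut-aut⁻¹ y = proj₂ (proj₂ (proj₁ A) y) refl

    aut⁻¹-aut : ∀ x → aut⁻¹ (a x) ≡ x
    aut⁻¹-aut x = aut-injective (aut-aut⁻¹ (a x))

    aut-ε : a ε ≡ ε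
    aut-ε = ∙-cancelˡ (a ε) (a ε) ε (begin
      a ε ∙ a ε ≡⟨ sym (aut-∙ ε ε) ⟩
      a (ε ∙ ε) ≡⟨ cong a (identityˡ ε) ⟩
      a ε       ≡⟨ sym (identityʳ (a ε)) ⟩
      a ε ∙ ε   ∎)

    aut-⁻¹ : ∀ x → a (x ⁻¹) ≡ a x ⁻¹
    aut-⁻¹ x = inverseˡ-unique (a (x ⁻¹)) (a x)
      (trans (sym (aut-∙ (x ⁻¹) x)) (trans (cong a (inverseˡ x)) aut-ε))

    aut-product : ∀ l → a (foldr _∙_ ε l) ≡ foldr _∙_ ε (map a l)
    aut-product []      = aut-ε
    aut-product (x ∷ l) = trans (aut-∙ x _) (cong (a x ∙_) (aut-product l))

    aut⁻¹-isAutomorphism : IsAutomorphism G aut⁻¹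
    aut⁻¹-isAutomorphism = mkAutomorphism
      (λ {x} {y} e → trans (sym (aut-aut⁻¹ x)) (trans (cong a e) (aut-aut⁻¹ y)))
      (λ y → a y , aut⁻¹-aut y)
      (λ x y → aut-injective (begin
        a (aut⁻¹ (x ∙ y))             ≡⟨ aut-aut⁻¹ (x ∙ y) ⟩
        x ∙ y                         ≡⟨ sym (cong₂ _∙_ (aut-aut⁻¹ x) (aut-aut⁻¹ y)) ⟩
        a (aut⁻¹ x) ∙ a (aut⁻¹ y)     ≡⟨ sym (aut-∙ (aut⁻¹ x) (aut⁻¹ y)) ⟩
        a (aut⁻¹ x ∙ aut⁻¹ y)         ∎))

  aut-cong : ∀ {a b} → (∀ x → a x ≡ b x) → IsAutomorphism G a → IsAutomorphism G b
  aut-cong {a} {b} a≗b A = mkAutomorphism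
    (λ {x} {y} e → aut-injective A (trans (a≗b x) (trans e (sym (a≗b y)))))
    (λ y → aut⁻¹ A y , trans (sym (a≗b _)) (aut-aut⁻¹ A y))
    (λ x y → trans (sym (a≗b (x ∙ y))) (trans (aut-∙ A x y) (cong₂ _∙_ (a≗b x) (a≗b y))))

  aut-∘ : ∀ {a b} → IsAutomorphism G a → IsAutomorphism G b → IsAutomorphism G (a ∘ b)
  aut-∘ {a} {b} A B = mkAutomorphism
    (aut-injective B ∘ aut-injective A)
    (λ y → aut⁻¹ B (aut⁻¹ A y) , trans (cong a (aut-aut⁻¹ B _)) (aut-aut⁻¹ A y))
    (λ x y → trans (cong a (aut-∙ B x y)) (aut-∙ A (b x) (b y)))

  id-isAutomorphism : IsAutomorphism G id
  id-isAutomorphism = mkAutomorphism id (λ y → y , refl) (λ _ _ → refl)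

  aut-tabulate : ∀ {a} → IsAutomorphism G a → IsAutomorphism G (app G (tabulate a))
  aut-tabulate = aut-cong (λ x → sym (app-tabulate _ x))

  aut-⊙ : ∀ α β → IsAutomorphism G (app G α) → IsAutomorphism G (app G β) →
          IsAutomorphism G (app G (α ⊙ β))
  aut-⊙ _ _ A B = aut-tabulate (aut-∘ A B)

  conj : Fin n → Fin n → Fin n
  conj g x = (g ∙ x) ∙ g ⁻¹

  conj-∙ : ∀ g h x → conj g (conj h x) ≡ conj (g ∙ h) x
  conj-∙ g h x = begin
    (g ∙ ((h ∙ x) ∙ h ⁻¹)) ∙ g ⁻¹  ≡⟨ cong (_∙ g ⁻¹) (sym (assoc g _ _)) ⟩
    ((g ∙ (h ∙ x)) ∙ h ⁻¹) ∙ g ⁻¹  ≡⟨ cong (λ z → (z ∙ h ⁻¹) ∙ g ⁻¹) (sym (assoc g h x)) ⟩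
    (((g ∙ h) ∙ x) ∙ h ⁻¹) ∙ g ⁻¹  ≡⟨ assoc _ _ _ ⟩
    ((g ∙ h) ∙ x) ∙ (h ⁻¹ ∙ g ⁻¹)  ≡⟨ cong (((g ∙ h) ∙ x) ∙_) (sym (⁻¹-anti-homo-∙ g h)) ⟩
    ((g ∙ h) ∙ x) ∙ (g ∙ h) ⁻¹     ∎

  conj-ε : ∀ x → conj ε x ≡ x
  conj-ε x = trans (cong₂ _∙_ (identityˡ x) ε⁻¹≈ε) (identityʳ x)

  conj-conj⁻¹ : ∀ g x → conj g (conj (g ⁻¹) x) ≡ x
  conj-conj⁻¹ g x = trans (conj-∙ g (g ⁻¹) x) (trans (cong (λ h → conj h x) (inverseʳ g)) (conj-ε x))

  conj⁻¹-conj : ∀ g x → conj (g ⁻¹) (conj g x) ≡ x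
  conj⁻¹-conj g x = trans (conj-∙ (g ⁻¹) g x) (trans (cong (λ h → conj h x) (inverseˡ g)) (conj-ε x))

  conj-isAutomorphism : ∀ g → IsAutomorphism G (conj g)
  conj-isAutomorphism g = mkAutomorphism
    (λ {x} {y} e → trans (sym (conj⁻¹-conj g x)) (trans (cong (conj (g ⁻¹)) e) (conj⁻¹-conj g y)))
    (λ y → conj (g ⁻¹) y , conj-conj⁻¹ g y)
    (λ x y → sym (begin
      ((g ∙ x) ∙ g ⁻¹) ∙ ((g ∙ y) ∙ g ⁻¹)  ≡⟨ sym (assoc _ _ _) ⟩
      (((g ∙ x) ∙ g ⁻¹) ∙ (g ∙ y)) ∙ g ⁻¹  ≡⟨ cong (_∙ g ⁻¹) (assoc _ _ _) ⟩
      ((g ∙ x) ∙ (g ⁻¹ ∙ (g ∙ y))) ∙ g ⁻¹  ≡⟨ cong (λ z → ((g ∙ x) ∙ z) ∙ g ⁻¹) (sym (assoc _ _ _)) ⟩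
      ((g ∙ x) ∙ ((g ⁻¹ ∙ g) ∙ y)) ∙ g ⁻¹  ≡⟨ cong (λ z → ((g ∙ x) ∙ (z ∙ y)) ∙ g ⁻¹) (inverseˡ g) ⟩
      ((g ∙ x) ∙ (ε ∙ y)) ∙ g ⁻¹           ≡⟨ cong (λ z → ((g ∙ x) ∙ z) ∙ g ⁻¹) (identityˡ y) ⟩
      ((g ∙ x) ∙ y) ∙ g ⁻¹                 ≡⟨ cong (_∙ g ⁻¹) (assoc g x y) ⟩
      (g ∙ (x ∙ y)) ∙ g ⁻¹                 ∎))

  inner-⊙ : ∀ α β → IsInner G α → IsInner G β → IsInner G (α ⊙ β)
  inner-⊙ α β (g , α≗conj) (h , β≗conj) = g ∙ h , λ x → begin
    app G (α ⊙ β) x        ≡⟨ app-⊙ α β x ⟩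
    app G α (app G β x)    ≡⟨ α≗conj _ ⟩
    conj g (app G β x)     ≡⟨ cong (conj g) (β≗conj x) ⟩
    conj g (conj h x)      ≡⟨ conj-∙ g h x ⟩
    conj (g ∙ h) x         ∎

  inner-aut⁻¹ : ∀ β (B : IsAutomorphism G (app G β)) → IsInner G β → IsInner G (tabulate (aut⁻¹ B))
  inner-aut⁻¹ β B (g , β≗conj) = g ⁻¹ , λ y → trans (app-tabulate _ y) (aut-injective B (begin
    app G β (aut⁻¹ B y)      ≡⟨ aut-aut⁻¹ B y ⟩
    y                        ≡⟨ sym (conj-conj⁻¹ g y) ⟩
    conj g (conj (g ⁻¹) y)   ≡⟨ sym (β≗conj _) ⟩
    app G β (conj (g ⁻¹) y)  ∎))

  ∈-image : ∀ α Ω {y} → y ∈ image G α Ω ⇔ (∃ λ x → x ∈ Ω × app G α x ≡ y)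
  ∈-image α Ω = ∈-tabulate (λ y → Fin.any? (λ x → (x ∈? Ω) ×-dec (app G α x Fin.≟ y)))

  ∈-image⁺ : ∀ α Ω {x} → x ∈ Ω → app G α x ∈ image G α Ω
  ∈-image⁺ α Ω {x} x∈Ω = Equivalence.from (∈-image α Ω) (x , x∈Ω , refl)

  ∈-image⁻ : ∀ α → IsAutomorphism G (app G α) → ∀ Ω {x} → app G α x ∈ image G α Ω → x ∈ Ω
  ∈-image⁻ α A Ω αx∈ with Equivalence.to (∈-image α Ω) αx∈
  ... | x' , x'∈Ω , αx'≡αx = subst (_∈ Ω) (aut-injective A αx'≡αx) x'∈Ω

  image-≡⁺ : ∀ β {Ω Ω'} → IsAutomorphism G (app G β) →
             (∀ x → x ∈ Ω ⇔ app G β x ∈ Ω') → image G β Ω ≡ Ω'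
  image-≡⁺ β {Ω} {Ω'} B Ω⇔Ω' = ⊆-antisym
    (λ y∈ → let x , x∈Ω , βx≡y = Equivalence.to (∈-image β Ω) y∈
            in subst (_∈ Ω') βx≡y (Equivalence.to (Ω⇔Ω' x) x∈Ω))
    (λ {y} y∈Ω' → subst (_∈ image G β Ω) (aut-aut⁻¹ B y)
      (∈-image⁺ β Ω (Equivalence.from (Ω⇔Ω' _) (subst (_∈ Ω') (sym (aut-aut⁻¹ B y)) y∈Ω'))))

  image-≡⁻ : ∀ β {Ω Ω'} → IsAutomorphism G (app G β) →
             image G β Ω ≡ Ω' → ∀ x → x ∈ Ω ⇔ app G β x ∈ Ω'
  image-≡⁻ β {Ω} B refl x = mk⇔ (∈-image⁺ β Ω) (∈-image⁻ β B Ω)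

  image-⊙ : ∀ α β Ω → image G (α ⊙ β) Ω ≡ image G α (image G β Ω)
  image-⊙ α β Ω = ⊆-antisym
    (λ y∈ → let x , x∈Ω , αβx≡y = Equivalence.to (∈-image (α ⊙ β) Ω) y∈
            in subst (_∈ image G α (image G β Ω)) (trans (sym (app-⊙ α β x)) αβx≡y)
                 (∈-image⁺ α _ (∈-image⁺ β Ω x∈Ω)))
    (λ y∈ → let z , z∈βΩ , αz≡y = Equivalence.to (∈-image α (image G β Ω)) y∈
                x , x∈Ω , βx≡z = Equivalence.to (∈-image β Ω) z∈βΩ
            in subst (_∈ image G (α ⊙ β) Ω) (trans (app-⊙ α β x) (trans (cong (app G α) βx≡z) αz≡y))
                 (∈-image⁺ (α ⊙ β) Ω x∈Ω))

  image-size : ∀ α → IsAutomorphism G (app G α) → ∀ Ω → ∣ image G α Ω ∣ ≡ ∣ Ω ∣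
  image-size α A Ω = ℤ.+-injective (begin
    + ∣ image G α Ω ∣                           ≡⟨ ∣p∣≡∑𝟙∈ (image G α Ω) ⟩
    ∑[ y ∈ allFin n ] 𝟙 (y ∈? image G α Ω)      ≡⟨ ∑-cong (allFin n) pull-back ⟩
    ∑[ y ∈ allFin n ] 𝟙 (aut⁻¹ A y ∈? Ω)        ≡⟨ ∑-reindex (allFin-isEnumeration n) (aut⁻¹ A) (app G α)
                                                     (aut⁻¹-aut A) (aut-aut⁻¹ A) (λ x → 𝟙 (x ∈? Ω)) ⟩
    ∑[ x ∈ allFin n ] 𝟙 (x ∈? Ω)                ≡⟨ sym (∣p∣≡∑𝟙∈ Ω) ⟩
    + ∣ Ω ∣                                     ∎)
    where
    pull-back : ∀ y → 𝟙 (y ∈? image G α Ω) ≡ 𝟙 (aut⁻¹ A y ∈? Ω)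
    pull-back y = 𝟙-⇔ (y ∈? image G α Ω) (aut⁻¹ A y ∈? Ω) (mk⇔
      (λ y∈ → ∈-image⁻ α A Ω (subst (_∈ image G α Ω) (sym (aut-aut⁻¹ A y)) y∈))
      (λ x∈ → subst (_∈ image G α Ω) (aut-aut⁻¹ A y) (∈-image⁺ α Ω x∈)))

  -- The generated subgroup

  Product : Subset n → Fin n → Set
  Product Ω g = ∃ λ (l : List (Fin n)) → All (_∈ Ω) l × foldr _∙_ ε l ≡ g

  product-++ : ∀ l l' → foldr _∙_ ε (l ++ l') ≡ foldr _∙_ ε l ∙ foldr _∙_ ε l'
  product-++ []      l' = sym (identityˡ _)
  product-++ (x ∷ l) l' = trans (cong (x ∙_) (product-++ l l')) (sym (assoc x _ _))

  module _ {Ω : Subset n} where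

    Product-∙ : ∀ {x y} → Product Ω x → Product Ω y → Product Ω (x ∙ y)
    Product-∙ (l , l⊆Ω , refl) (l' , l'⊆Ω , refl) = l ++ l' , All.++⁺ l⊆Ω l'⊆Ω , product-++ l l'

    Product-⁻¹ : IsSymmetric G Ω → ∀ {x} → Product Ω x → Product Ω (x ⁻¹)
    Product-⁻¹ Ω-sym ([]    , []           , refl) = [] , [] , sym ε⁻¹≈ε
    Product-⁻¹ Ω-sym (x ∷ l , x∈Ω ∷ l⊆Ω , refl) =
      subst (Product Ω) (sym (⁻¹-anti-homo-∙ x _))
        (Product-∙ (Product-⁻¹ Ω-sym (l , l⊆Ω , refl)) (x ⁻¹ ∷ [] , Ω-sym x x∈Ω ∷ [] , identityʳ _))

    Product⇒∈subgroup : ∀ {K} → IsSubgroup G K → Ω ⊆ K → ∀ {y} → Product Ω y → y ∈ K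
    Product⇒∈subgroup (ε∈K , _) Ω⊆K ([] , [] , refl) = ε∈K
    Product⇒∈subgroup K≤G@(_ , ∙-closed , _) Ω⊆K (x ∷ l , x∈Ω ∷ l⊆Ω , refl) =
      ∙-closed x _ (Ω⊆K x∈Ω) (Product⇒∈subgroup K≤G Ω⊆K (l , l⊆Ω , refl))

  _⋆_ : Subset n → Subset n → Subset n
  Ω ⋆ S = tabulate λ y → ⌊ ⋆? y ⌋
    where
    ⋆? : ∀ y → Dec (∃ λ x → ∃ λ s → x ∈ Ω × s ∈ S × x ∙ s ≡ y)
    ⋆? y = Fin.any? λ x → Fin.any? λ s → (x ∈? Ω) ×-dec (s ∈? S) ×-dec (x ∙ s Fin.≟ y)

  ∈-⋆ : ∀ Ω S {y} → y ∈ Ω ⋆ S ⇔ (∃ λ x → ∃ λ s → x ∈ Ω × s ∈ S × x ∙ s ≡ y)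
  ∈-⋆ Ω S = ∈-tabulate _

  extend : Subset n → Subset n → Subset n
  extend Ω S = S ∪ Ω ⋆ S

  -- The subgroup generated by Ω: iterating S ↦ S ∪ Ω S from {ε} stabilises within n + 1 steps.
  ⟨_⟩ : Subset n → Subset n
  ⟨ Ω ⟩ = fold ⁅ ε ⁆ (extend Ω) (suc n)

  module _ {Ω : Subset n} where

    private
      ⊆-extend : ∀ S → S ⊆ extend Ω S
      ⊆-extend S = p⊆p∪q (Ω ⋆ S)

    ε∈⟨⟩ : ε ∈ ⟨ Ω ⟩
    ε∈⟨⟩ = ⊆-fold (extend Ω) ⊆-extend ⁅ ε ⁆ (suc n) (x∈⁅x⁆ ε)

    ⟨⟩-closed : ∀ {x s} → x ∈ Ω → s ∈ ⟨ Ω ⟩ → x ∙ s ∈ ⟨ Ω ⟩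
    ⟨⟩-closed {x} {s} x∈Ω s∈ =
      subst (x ∙ s ∈_) (fold-fixedPoint (extend Ω) ⊆-extend ⁅ ε ⁆)
        (q⊆p∪q ⟨ Ω ⟩ (Ω ⋆ ⟨ Ω ⟩) (Equivalence.from (∈-⋆ Ω ⟨ Ω ⟩) (x , s , x∈Ω , s∈ , refl)))

    ∈fold⇒Product : ∀ i {y} → y ∈ fold ⁅ ε ⁆ (extend Ω) i → Product Ω y
    ∈fold⇒Product zero    y∈ = [] , [] , sym (x∈⁅y⁆⇒x≡y ε y∈)
    ∈fold⇒Product (suc i) y∈ with x∈p∪q⁻ _ _ y∈
    ... | inj₁ y∈Sᵢ = ∈fold⇒Product i y∈Sᵢ
    ... | inj₂ y∈ΩSᵢ with Equivalence.to (∈-⋆ Ω _) y∈ΩSᵢ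
    ...   | x , s , x∈Ω , s∈Sᵢ , refl with ∈fold⇒Product i s∈Sᵢ
    ...     | l , l⊆Ω , refl = x ∷ l , x∈Ω ∷ l⊆Ω , refl

    ∈⟨⟩⇒Product : ∀ {y} → y ∈ ⟨ Ω ⟩ → Product Ω y
    ∈⟨⟩⇒Product = ∈fold⇒Product (suc n)

    Product⇒∈⟨⟩ : ∀ {y} → Product Ω y → y ∈ ⟨ Ω ⟩
    Product⇒∈⟨⟩ ([]    , []          , refl) = ε∈⟨⟩
    Product⇒∈⟨⟩ (x ∷ l , x∈Ω ∷ l⊆Ω , refl) = ⟨⟩-closed x∈Ω (Product⇒∈⟨⟩ (l , l⊆Ω , refl))

    ⊆⟨⟩ : Ω ⊆ ⟨ Ω ⟩
    ⊆⟨⟩ x∈Ω = Product⇒∈⟨⟩ (_ ∷ [] , x∈Ω ∷ [] , identityʳ _)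

    ⟨⟩-isSubgroup : IsSymmetric G Ω → IsSubgroup G ⟨ Ω ⟩
    ⟨⟩-isSubgroup Ω-sym =
      ε∈⟨⟩ ,
      (λ x y x∈ y∈ → Product⇒∈⟨⟩ (Product-∙ (∈⟨⟩⇒Product x∈) (∈⟨⟩⇒Product y∈))) ,
      (λ x x∈ → Product⇒∈⟨⟩ (Product-⁻¹ Ω-sym (∈⟨⟩⇒Product x∈)))

    ⟨⟩-least : ∀ {K} → IsSubgroup G K → Ω ⊆ K → ⟨ Ω ⟩ ⊆ K
    ⟨⟩-least K≤G Ω⊆K = Product⇒∈subgroup K≤G Ω⊆K ∘ ∈⟨⟩⇒Product

    ⟨⟩≡⊤⇔generates : ⟨ Ω ⟩ ≡ ⊤ ⇔ Generates G Ω
    ⟨⟩≡⊤⇔generates = mk⇔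
      (λ ⟨Ω⟩≡⊤ g → ∈⟨⟩⇒Product (subst (g ∈_) (sym ⟨Ω⟩≡⊤) ∈⊤))
      (λ Ω-gen → ⊆-antisym ⊆⊤ (λ {g} _ → Product⇒∈⟨⟩ (Ω-gen g)))

  symmetric? : ∀ Ω → Dec (IsSymmetric G Ω)
  symmetric? Ω = Fin.all? λ x → (x ∈? Ω) →-dec ((x ⁻¹) ∈? Ω)

  generates? : ∀ Ω → Dec (Generates G Ω)
  generates? Ω = Dec.map ⟨⟩≡⊤⇔generates (Vec.≡-dec Bool._≟_ ⟨ Ω ⟩ ⊤)

  connectionSet? : ∀ k Ω → Dec (IsConnectionSet G k Ω)
  connectionSet? k Ω = symmetric? Ω ×-dec ¬? (ε ∈? Ω) ×-dec generates? Ω ×-dec (∣ Ω ∣ ℕ.≟ k)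

  fixed? : ∀ α Ω → Dec (image G α Ω ≡ Ω)
  fixed? α Ω = Vec.≡-dec Bool._≟_ (image G α Ω) Ω

  -- Möbius inversion

  symmetricFixed? : ∀ α k Ω → Dec (IsSymmetric G Ω × ε ∉ Ω × image G α Ω ≡ Ω × ∣ Ω ∣ ≡ k)
  symmetricFixed? α k Ω = symmetric? Ω ×-dec ¬? (ε ∈? Ω) ×-dec fixed? α Ω ×-dec (∣ Ω ∣ ℕ.≟ k)

  module _ {μ : Subset n → ℤ} (μ-isMobius : IsMobius G μ) where

    ∑-μ-supergroups : ∀ {Ω} → IsSymmetric G Ω →
                      ∑[ K ∈ subgroupList G ] 𝟙 (Ω ⊆? K) * μ K ≡ 𝟙 (generates? Ω)
    ∑-μ-supergroups {Ω} Ω-sym = begin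
      ∑[ K ∈ subgroupList G ] 𝟙 (Ω ⊆? K) * μ K
        ≡⟨ ∑-filter-cong (isSubgroup? G) (allSubsets n) (λ K K≤G →
             cong (_* μ K) (𝟙-⇔ (Ω ⊆? K) (⟨ Ω ⟩ ⊆? K) (⊆⇔⟨⟩⊆ K≤G))) ⟩
      ∑[ K ∈ subgroupList G ] 𝟙 (⟨ Ω ⟩ ⊆? K) * μ K
        ≡⟨ sym (∑-filter (⟨ Ω ⟩ ⊆?_) (subgroupList G) μ) ⟩
      ∑ (filter (⟨ Ω ⟩ ⊆?_) (subgroupList G)) μ
        ≡⟨ μ-isMobius ⟨ Ω ⟩ (⟨⟩-isSubgroup Ω-sym) ⟩
      𝟙 (Vec.≡-dec Bool._≟_ ⟨ Ω ⟩ ⊤)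
        ≡⟨ 𝟙-⇔ (Vec.≡-dec Bool._≟_ ⟨ Ω ⟩ ⊤) (generates? Ω) ⟨⟩≡⊤⇔generates ⟩
      𝟙 (generates? Ω)
        ∎
      where
      ⊆⇔⟨⟩⊆ : ∀ {K} → IsSubgroup G K → Ω ⊆ K ⇔ ⟨ Ω ⟩ ⊆ K
      ⊆⇔⟨⟩⊆ K≤G = mk⇔ (⟨⟩-least K≤G) (λ ⟨Ω⟩⊆K x∈Ω → ⟨Ω⟩⊆K (⊆⟨⟩ x∈Ω))

    𝟙-symmetricFixed-∑μ : ∀ α k Ω →
      𝟙 (symmetricFixed? α k Ω) * (∑[ K ∈ subgroupList G ] 𝟙 (Ω ⊆? K) * μ K)
        ≡ 𝟙 (connectionSet? k Ω) * 𝟙 (fixed? α Ω)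
    𝟙-symmetricFixed-∑μ α k Ω with symmetricFixed? α k Ω
    ... | yes (Ω-sym , ε∉Ω , Ω-fixed , ∣Ω∣≡k) = begin
      + 1 * (∑[ K ∈ subgroupList G ] 𝟙 (Ω ⊆? K) * μ K)
        ≡⟨ ℤ.*-identityˡ _ ⟩
      ∑[ K ∈ subgroupList G ] 𝟙 (Ω ⊆? K) * μ K
        ≡⟨ ∑-μ-supergroups Ω-sym ⟩
      𝟙 (generates? Ω)
        ≡⟨ 𝟙-⇔ (generates? Ω) (connectionSet? k Ω)
             (mk⇔ (λ gen → Ω-sym , ε∉Ω , gen , ∣Ω∣≡k) (proj₁ ∘ proj₂ ∘ proj₂)) ⟩
      𝟙 (connectionSet? k Ω)
        ≡⟨ sym (ℤ.*-identityʳ _) ⟩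
      𝟙 (connectionSet? k Ω) * + 1
        ≡⟨ cong (𝟙 (connectionSet? k Ω) *_) (sym (𝟙-yes (fixed? α Ω) Ω-fixed)) ⟩
      𝟙 (connectionSet? k Ω) * 𝟙 (fixed? α Ω)
        ∎
    ... | no ¬symmetricFixed with connectionSet? k Ω | fixed? α Ω
    ...   | yes (Ω-sym , ε∉Ω , _ , ∣Ω∣≡k) | yes Ω-fixed =
      contradiction (Ω-sym , ε∉Ω , Ω-fixed , ∣Ω∣≡k) ¬symmetricFixed
    ...   | yes _ | no _ = refl
    ...   | no _  | _    = refl

    innerCoeff≡#fixedConnectionSets : ∀ α k →
      innerCoeff G μ α k ≡ ∑[ Ω ∈ allSubsets n ] 𝟙 (connectionSet? k Ω) * 𝟙 (fixed? α Ω)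
    innerCoeff≡#fixedConnectionSets α k = begin
      ∑[ K ∈ SG ] μ K * + length (filter (fixedInS? G α K k) AS)
        ≡⟨ ∑-cong SG (λ K → cong (μ K *_) (length-filter (fixedInS? G α K k) AS)) ⟩
      ∑[ K ∈ SG ] μ K * (∑[ Ω ∈ AS ] 𝟙 (fixedInS? G α K k Ω))
        ≡⟨ ∑-cong SG (λ K → *-distribˡ-∑ AS (μ K) _) ⟩
      ∑[ K ∈ SG ] ∑[ Ω ∈ AS ] μ K * 𝟙 (fixedInS? G α K k Ω)
        ≡⟨ ∑-comm SG AS _ ⟩
      ∑[ Ω ∈ AS ] ∑[ K ∈ SG ] μ K * 𝟙 (fixedInS? G α K k Ω)
        ≡⟨ ∑-cong AS (λ Ω → ∑-cong SG (λ K → split Ω K)) ⟩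
      ∑[ Ω ∈ AS ] ∑[ K ∈ SG ] 𝟙 (symmetricFixed? α k Ω) * (𝟙 (Ω ⊆? K) * μ K)
        ≡⟨ ∑-cong AS (λ Ω → sym (*-distribˡ-∑ SG (𝟙 (symmetricFixed? α k Ω)) _)) ⟩
      ∑[ Ω ∈ AS ] 𝟙 (symmetricFixed? α k Ω) * (∑[ K ∈ SG ] 𝟙 (Ω ⊆? K) * μ K)
        ≡⟨ ∑-cong AS (𝟙-symmetricFixed-∑μ α k) ⟩
      ∑[ Ω ∈ AS ] 𝟙 (connectionSet? k Ω) * 𝟙 (fixed? α Ω)
        ∎
      where
      SG = subgroupList G
      AS = allSubsets n
      split : ∀ Ω K → μ K * 𝟙 (fixedInS? G α K k Ω) ≡ 𝟙 (symmetricFixed? α k Ω) * (𝟙 (Ω ⊆? K) * μ K)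
      split Ω K = trans (cong (μ K *_) (𝟙-× (Ω ⊆? K) (symmetricFixed? α k Ω)))
                        (rearrange (μ K) (𝟙 (Ω ⊆? K)) (𝟙 (symmetricFixed? α k Ω)))
        where
        rearrange : ∀ a b c → a * (b * c) ≡ c * (b * a)
        rearrange = solve-∀

    sumCoeff≡#fixedConnectionSets : ∀ L k →
      sumCoeff G μ L k ≡ ∑[ α ∈ L ] ∑[ Ω ∈ allSubsets n ] 𝟙 (connectionSet? k Ω) * 𝟙 (fixed? α Ω)
    sumCoeff≡#fixedConnectionSets L k = ∑-cong L (λ α → innerCoeff≡#fixedConnectionSets α k)

    sumCoeff-vanishes : ∀ L k → (∀ Ω → ¬ IsConnectionSet G k Ω) → sumCoeff G μ L k ≡ + 0
    sumCoeff-vanishes L k none = trans (sumCoeff≡#fixedConnectionSets L k)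
      (∑-zero L (λ α → ∑-zero (allSubsets n) (λ Ω →
        cong (_* 𝟙 (fixed? α Ω)) (𝟙-no (connectionSet? k Ω) (none Ω)))))

  connectionSet-size< : ∀ {k Ω} → IsConnectionSet G k Ω → k < n
  connectionSet-size< (_ , ε∉Ω , _ , ∣Ω∣≡k) =
    subst₂ _<_ ∣Ω∣≡k (∣⊤∣≡n n) (p⊂q⇒∣p∣<∣q∣ (⊆⊤ , ε , ∈⊤ , ε∉Ω))

  connectionSet-size≢0 : 2 ≤ n → ∀ {Ω} → ¬ IsConnectionSet G 0 Ω
  connectionSet-size≢0 2≤n (_ , _ , Ω-gen , ∣Ω∣≡0) with other-element 2≤n ε
  ... | g , g≢ε with Ω-gen g
  ...   | []    , _       , ε≡g = g≢ε (sym ε≡g)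
  ...   | x ∷ _ , x∈Ω ∷ _ , _   = ℕ.n≮0 (ℕ.<-≤-trans (x∈p⇒∣p-x∣<∣p∣ x∈Ω) (ℕ.≤-reflexive ∣Ω∣≡0))

  connectionSet-image : ∀ α {k Ω} → IsAutomorphism G (app G α) →
                        IsConnectionSet G k Ω → IsConnectionSet G k (image G α Ω)
  connectionSet-image α {k} {Ω} A (Ω-sym , ε∉Ω , Ω-gen , ∣Ω∣≡k) =
    αΩ-sym , ε∉αΩ , αΩ-gen , trans (image-size α A Ω) ∣Ω∣≡k
    where
    αΩ-sym : IsSymmetric G (image G α Ω)
    αΩ-sym y y∈ with Equivalence.to (∈-image α Ω) y∈
    ... | x , x∈Ω , refl = subst (_∈ image G α Ω) (aut-⁻¹ A x) (∈-image⁺ α Ω (Ω-sym x x∈Ω))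
    ε∉αΩ : ε ∉ image G α Ω
    ε∉αΩ ε∈ = ε∉Ω (∈-image⁻ α A Ω (subst (_∈ image G α Ω) (sym (aut-ε A)) ε∈))
    αΩ-gen : Generates G (image G α Ω)
    αΩ-gen g with Ω-gen (aut⁻¹ A g)
    ... | l , l⊆Ω , l≡ = map (app G α) l , All.gmap⁺ (∈-image⁺ α Ω) l⊆Ω , (begin
      foldr _∙_ ε (map (app G α) l) ≡⟨ sym (aut-product A l) ⟩
      app G α (foldr _∙_ ε l)       ≡⟨ cong (app G α) l≡ ⟩
      app G α (aut⁻¹ A g)           ≡⟨ aut-aut⁻¹ A g ⟩
      g                             ∎)

  -- Orbit counting

  -- ∑-elements says that `elements` lists each member exactly once.
  record AutomorphismSubgroup : Set₁ where
    field
      Member         : Map G → Set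
      member?        : Decidable Member
      elements       : List (Map G)
      ∑-elements     : ∀ f → ∑ elements f ≡ ∑[ α ∈ maps ] 𝟙 (member? α) * f α
      automorphism   : ∀ {α} → Member α → IsAutomorphism G (app G α)
      ⊙-closed       : ∀ {α β} → Member α → Member β → Member (α ⊙ β)
      inverse-closed : ∀ {β} (β∈ : Member β) → Member (tabulate (aut⁻¹ (automorphism β∈)))

  SameOrbit : AutomorphismSubgroup → Subset n → Subset n → Set
  SameOrbit Γ Ω Ω' = ∃ λ β → AutomorphismSubgroup.Member Γ β × image G β Ω ≡ Ω'

  module _ (Γ : AutomorphismSubgroup) where

    open AutomorphismSubgroup Γ

    ∑-elements-⊙ʳ : ∀ {β} → Member β → (f : Map G → ℤ) → ∑[ α ∈ elements ] f (α ⊙ β) ≡ ∑ elements f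
    ∑-elements-⊙ʳ {β} β∈ f = begin
      ∑[ α ∈ elements ] f (α ⊙ β)
        ≡⟨ ∑-elements _ ⟩
      ∑[ α ∈ maps ] 𝟙 (member? α) * f (α ⊙ β)
        ≡⟨ ∑-cong maps (λ α → cong (_* f (α ⊙ β)) (𝟙-member-⊙ α)) ⟩
      ∑[ α ∈ maps ] 𝟙 (member? (α ⊙ β)) * f (α ⊙ β)
        ≡⟨ ∑-reindex (allVecs-isEnumeration n n) (_⊙ β) (_⊙ β⁻¹)
             (⊙-cancelʳ β β⁻¹ β⁻¹β≗id) (⊙-cancelʳ β⁻¹ β ββ⁻¹≗id) (λ α → 𝟙 (member? α) * f α) ⟩
      ∑[ α ∈ maps ] 𝟙 (member? α) * f α
        ≡⟨ sym (∑-elements f) ⟩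
      ∑ elements f
        ∎
      where
      B = automorphism β∈
      β⁻¹ = tabulate (aut⁻¹ B)
      β⁻¹β≗id : ∀ x → app G β⁻¹ (app G β x) ≡ x
      β⁻¹β≗id x = trans (app-tabulate _ _) (aut⁻¹-aut B x)
      ββ⁻¹≗id : ∀ x → app G β (app G β⁻¹ x) ≡ x
      ββ⁻¹≗id x = trans (cong (app G β) (app-tabulate _ x)) (aut-aut⁻¹ B x)
      𝟙-member-⊙ : ∀ α → 𝟙 (member? α) ≡ 𝟙 (member? (α ⊙ β))
      𝟙-member-⊙ α = 𝟙-⇔ (member? α) (member? (α ⊙ β)) (mk⇔
        (λ α∈ → ⊙-closed α∈ β∈)
        (λ αβ∈ → subst Member (⊙-cancelʳ β⁻¹ β ββ⁻¹≗id α) (⊙-closed αβ∈ (inverse-closed β∈))))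

    module _ {P : Subset n → Set} (P? : Decidable P)
             (P-invariant : ∀ {α Ω} → Member α → P Ω → P (image G α Ω)) where

      private
        #mapping : Subset n → Subset n → ℤ
        #mapping Ω Ω' = ∑[ α ∈ elements ] 𝟙 (Vec.≡-dec Bool._≟_ (image G α Ω) Ω')

        #fixing : Subset n → ℤ
        #fixing Ω = ∑[ α ∈ elements ] 𝟙 (fixed? α Ω)

        ∑-#mapping : ∀ Ω → ∑[ Ω' ∈ allSubsets n ] #mapping Ω Ω' ≡ + length elements
        ∑-#mapping Ω = begin
          ∑[ Ω' ∈ allSubsets n ] #mapping Ω Ω'   ≡⟨ ∑-comm (allSubsets n) elements _ ⟩
          ∑[ α ∈ elements ] ∑[ Ω' ∈ allSubsets n ] 𝟙 (Vec.≡-dec Bool._≟_ (image G α Ω) Ω')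
            ≡⟨ ∑-cong elements (λ α → ∑-indicator (allSubsets-isEnumeration n) (image G α Ω)) ⟩
          ∑[ α ∈ elements ] + 1                   ≡⟨ ∑-const elements (+ 1) ⟩
          + 1 * + length elements                 ≡⟨ ℤ.*-identityˡ _ ⟩
          + length elements                       ∎

        #mapping-zero : ∀ Ω Ω' → (∀ {α} → Member α → image G α Ω ≢ Ω') → #mapping Ω Ω' ≡ + 0
        #mapping-zero Ω Ω' unreachable = trans (∑-elements _) (∑-zero maps none)
          where
          none : ∀ α → 𝟙 (member? α) * 𝟙 (Vec.≡-dec Bool._≟_ (image G α Ω) Ω') ≡ + 0
          none α with member? α | Vec.≡-dec Bool._≟_ (image G α Ω) Ω'
          ... | yes α∈ | yes αΩ≡Ω' = contradiction αΩ≡Ω' (unreachable α∈)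
          ... | yes _  | no _      = refl
          ... | no _   | _         = refl

      -- Burnside's lemma: count the pairs (α, Ω) with α(rᵢ) = Ω, first by the
      -- representative rᵢ, then by Ω, whose orbit contains exactly one rᵢ.
      orbit-counting : ∀ a → ClassCount P (SameOrbit Γ) a →
        + length elements * + a ≡ ∑[ α ∈ elements ] ∑[ Ω ∈ allSubsets n ] 𝟙 (P? Ω) * 𝟙 (fixed? α Ω)
      orbit-counting a (reps , reps-P , reps-distinct , reps-cover) = begin
        + length elements * + a
          ≡⟨ cong (λ m → + length elements * + m) (sym (List.length-tabulate id)) ⟩
        + length elements * + length (allFin a)
          ≡⟨ sym (∑-const (allFin a) _) ⟩
        ∑[ i ∈ allFin a ] + length elements
          ≡⟨ ∑-cong (allFin a) (λ i → sym (∑-#mapping (r i))) ⟩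
        ∑[ i ∈ allFin a ] ∑[ Ω ∈ AS ] #mapping (r i) Ω
          ≡⟨ ∑-comm (allFin a) AS _ ⟩
        ∑[ Ω ∈ AS ] ∑[ i ∈ allFin a ] #mapping (r i) Ω
          ≡⟨ ∑-cong AS (λ Ω → sym (orbit-sum Ω)) ⟩
        ∑[ Ω ∈ AS ] 𝟙 (P? Ω) * #fixing Ω
          ≡⟨ ∑-cong AS (λ Ω → *-distribˡ-∑ elements (𝟙 (P? Ω)) _) ⟩
        ∑[ Ω ∈ AS ] ∑[ α ∈ elements ] 𝟙 (P? Ω) * 𝟙 (fixed? α Ω)
          ≡⟨ ∑-comm AS elements _ ⟩
        ∑[ α ∈ elements ] ∑[ Ω ∈ AS ] 𝟙 (P? Ω) * 𝟙 (fixed? α Ω)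
          ∎
        where
        AS = allSubsets n
        r = lookup reps

        only-representative : ∀ {Ω i₀ β} → Member β → image G β Ω ≡ r i₀ →
                              ∀ i → 𝟙 (i₀ Fin.≟ i) * #fixing Ω ≡ #mapping (r i) Ω
        only-representative {Ω} {i₀} {β} β∈ βΩ≡r i with i₀ Fin.≟ i
        ... | yes refl = trans (ℤ.*-identityˡ _) (sym (begin
          #mapping (r i₀) Ω
            ≡⟨ ∑-cong elements (λ α → cong (λ S → 𝟙 (Vec.≡-dec Bool._≟_ S Ω))
                 (trans (cong (image G α) (sym βΩ≡r)) (sym (image-⊙ α β Ω)))) ⟩
          ∑[ α ∈ elements ] 𝟙 (fixed? (α ⊙ β) Ω)
            ≡⟨ ∑-elements-⊙ʳ β∈ (λ γ → 𝟙 (fixed? γ Ω)) ⟩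
          #fixing Ω
            ∎))
        ... | no i₀≢i = sym (#mapping-zero (r i) Ω (λ {α} α∈ αrᵢ≡Ω → i₀≢i (sym (reps-distinct i i₀
                (β ⊙ α , ⊙-closed β∈ α∈ ,
                 trans (image-⊙ β α (r i)) (trans (cong (image G β) αrᵢ≡Ω) βΩ≡r))))))

        orbit-sum : ∀ Ω → 𝟙 (P? Ω) * #fixing Ω ≡ ∑[ i ∈ allFin a ] #mapping (r i) Ω
        orbit-sum Ω with P? Ω
        ... | no ¬PΩ = sym (∑-zero (allFin a) (λ i → #mapping-zero (r i) Ω
                (λ α∈ αrᵢ≡Ω → ¬PΩ (subst P αrᵢ≡Ω (P-invariant α∈ (reps-P i))))))
        ... | yes PΩ with reps-cover Ω PΩ
        ...   | i₀ , β , β∈ , βΩ≡r = begin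
          + 1 * #fixing Ω
            ≡⟨ ℤ.*-identityˡ _ ⟩
          #fixing Ω
            ≡⟨ sym (∑-pick (allFin-isEnumeration a) i₀ (λ _ → #fixing Ω)) ⟩
          ∑[ i ∈ allFin a ] 𝟙 (i₀ Fin.≟ i) * #fixing Ω
            ≡⟨ ∑-cong (allFin a) (only-representative β∈ βΩ≡r) ⟩
          ∑[ i ∈ allFin a ] #mapping (r i) Ω
            ∎

  Aut : AutomorphismSubgroup
  Aut = record
    { Member         = λ α → IsAutomorphism G (app G α)
    ; member?        = isAutomorphism? G
    ; elements       = autList G
    ; ∑-elements     = ∑-filter (isAutomorphism? G) maps
    ; automorphism   = id
    ; ⊙-closed       = λ {α} {β} → aut-⊙ α β
    ; inverse-closed = aut-tabulate ∘ aut⁻¹-isAutomorphism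
    }

  Inn : AutomorphismSubgroup
  Inn = record
    { Member         = λ α → IsAutomorphism G (app G α) × IsInner G α
    ; member?        = isInnerAutomorphism?
    ; elements       = innList G
    ; ∑-elements     = ∑-innList
    ; automorphism   = proj₁
    ; ⊙-closed       = λ {α} {β} (A , I) (B , J) → aut-⊙ α β A B , inner-⊙ α β I J
    ; inverse-closed = λ {β} (A , I) → aut-tabulate (aut⁻¹-isAutomorphism A) , inner-aut⁻¹ β A I
    }
    where
    isInnerAutomorphism? : ∀ α → Dec (IsAutomorphism G (app G α) × IsInner G α)
    isInnerAutomorphism? α = isAutomorphism? G α ×-dec isInner? G α
    ∑-innList : ∀ f → ∑ (innList G) f ≡ ∑[ α ∈ maps ] 𝟙 (isInnerAutomorphism? α) * f α
    ∑-innList f = begin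
      ∑ (filter (isInner? G) (autList G)) f
        ≡⟨ ∑-filter (isInner? G) (autList G) f ⟩
      ∑[ α ∈ autList G ] 𝟙 (isInner? G α) * f α
        ≡⟨ ∑-filter (isAutomorphism? G) maps _ ⟩
      ∑[ α ∈ maps ] 𝟙 (isAutomorphism? G α) * (𝟙 (isInner? G α) * f α)
        ≡⟨ ∑-cong maps (λ α → trans (sym (ℤ.*-assoc (𝟙 (isAutomorphism? G α)) (𝟙 (isInner? G α)) (f α)))
                                    (cong (_* f α) (sym (𝟙-× (isAutomorphism? G α) (isInner? G α))))) ⟩
      ∑[ α ∈ maps ] 𝟙 (isInnerAutomorphism? α) * f α
        ∎

  cayleyIso : ∀ β {Ω Ω' f} → IsAutomorphism G (app G β) → image G β Ω ≡ Ω' →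
              Bijective _≡_ _≡_ f → (∀ g h → f g ⁻¹ ∙ f h ≡ app G β (g ⁻¹ ∙ h)) →
              IsCayleyIso G Ω Ω' f
  cayleyIso β {Ω' = Ω'} B βΩ≡Ω' f-bijective f-adj = f-bijective , λ g h →
    (λ adj → subst (_∈ Ω') (sym (f-adj g h)) (Equivalence.to (image-≡⁻ β B βΩ≡Ω' (g ⁻¹ ∙ h)) adj)) ,
    (λ adj → Equivalence.from (image-≡⁻ β B βΩ≡Ω' (g ⁻¹ ∙ h)) (subst (_∈ Ω') (f-adj g h) adj))

  image⇒weaklyEquivalent : ∀ {Ω Ω'} → SameOrbit Aut Ω Ω' → WeaklyEquivalent G Ω Ω'
  image⇒weaklyEquivalent (β , B , βΩ≡Ω') =
    app G β , cayleyIso β B βΩ≡Ω' (proj₁ B) adj , app G β , B , aut-∙ B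
    where
    adj : ∀ g h → app G β g ⁻¹ ∙ app G β h ≡ app G β (g ⁻¹ ∙ h)
    adj g h = trans (cong (_∙ app G β h) (sym (aut-⁻¹ B g))) (sym (aut-∙ B (g ⁻¹) h))

  image⇒equivalent : ∀ {Ω Ω'} → SameOrbit Inn Ω Ω' → Equivalent G Ω Ω'
  image⇒equivalent (β , (B , g , β≗conj) , βΩ≡Ω') =
    (_∙ g ⁻¹) , cayleyIso β B βΩ≡Ω' (∙g⁻¹-injective , ∙g⁻¹-surjective) adj , λ g' u → assoc g' u (g ⁻¹)
    where
    ∙g⁻¹-injective : ∀ {x y} → x ∙ g ⁻¹ ≡ y ∙ g ⁻¹ → x ≡ y
    ∙g⁻¹-injective {x} {y} = ∙-cancelʳ (g ⁻¹) x y
    ∙g⁻¹-surjective : ∀ y → ∃ λ x → ∀ {z} → z ≡ x → z ∙ g ⁻¹ ≡ y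
    ∙g⁻¹-surjective y = y ∙ g , λ { refl →
      trans (assoc y g (g ⁻¹)) (trans (cong (y ∙_) (inverseʳ g)) (identityʳ y)) }
    adj : ∀ x y → (x ∙ g ⁻¹) ⁻¹ ∙ (y ∙ g ⁻¹) ≡ app G β (x ⁻¹ ∙ y)
    adj x y = begin
      (x ∙ g ⁻¹) ⁻¹ ∙ (y ∙ g ⁻¹)       ≡⟨ cong (_∙ (y ∙ g ⁻¹)) (⁻¹-anti-homo-∙ x (g ⁻¹)) ⟩
      (g ⁻¹ ⁻¹ ∙ x ⁻¹) ∙ (y ∙ g ⁻¹)    ≡⟨ cong (λ z → (z ∙ x ⁻¹) ∙ (y ∙ g ⁻¹)) (⁻¹-involutive g) ⟩
      (g ∙ x ⁻¹) ∙ (y ∙ g ⁻¹)          ≡⟨ sym (assoc _ y (g ⁻¹)) ⟩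
      ((g ∙ x ⁻¹) ∙ y) ∙ g ⁻¹          ≡⟨ cong (_∙ g ⁻¹) (assoc g (x ⁻¹) y) ⟩
      conj g (x ⁻¹ ∙ y)                ≡⟨ sym (β≗conj (x ⁻¹ ∙ y)) ⟩
      app G β (x ⁻¹ ∙ y)               ∎

  -- An isomorphism with f (g u) = a(g) f(u) satisfies f(x) = a(x) f(ε), so reading the
  -- adjacency of ε and x shows that x ↦ f(ε)⁻¹ a(x) f(ε) carries Ω onto Ω'.
  equivariantIso⇒image : ∀ {Ω Ω' f a} → IsCayleyIso G Ω Ω' f → IsAutomorphism G a →
                         (∀ g u → f (g ∙ u) ≡ a g ∙ f u) →
                         image G (tabulate (conj (f ε ⁻¹) ∘ a)) Ω ≡ Ω'
  equivariantIso⇒image {Ω} {Ω'} {f} {a} (_ , f-adj) A f-equivariant =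
    image-≡⁺ (tabulate (conj (f ε ⁻¹) ∘ a)) (aut-tabulate (aut-∘ (conj-isAutomorphism (f ε ⁻¹)) A))
      λ x → mk⇔
      (λ x∈Ω → subst (_∈ Ω') (f-from-ε x) (proj₁ (f-adj ε x) (subst (_∈ Ω) (sym (ε⁻¹∙ x)) x∈Ω)))
      (λ fx∈Ω' → subst (_∈ Ω) (ε⁻¹∙ x) (proj₂ (f-adj ε x) (subst (_∈ Ω') (sym (f-from-ε x)) fx∈Ω')))
    where
    c = f ε
    ε⁻¹∙ : ∀ x → ε ⁻¹ ∙ x ≡ x
    ε⁻¹∙ x = trans (cong (_∙ x) ε⁻¹≈ε) (identityˡ x)
    f-from-ε : ∀ x → c ⁻¹ ∙ f x ≡ app G (tabulate (conj (c ⁻¹) ∘ a)) x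
    f-from-ε x = begin
      c ⁻¹ ∙ f x                 ≡⟨ cong (λ u → c ⁻¹ ∙ f u) (sym (identityʳ x)) ⟩
      c ⁻¹ ∙ f (x ∙ ε)           ≡⟨ cong (c ⁻¹ ∙_) (f-equivariant x ε) ⟩
      c ⁻¹ ∙ (a x ∙ c)           ≡⟨ sym (assoc _ _ _) ⟩
      (c ⁻¹ ∙ a x) ∙ c           ≡⟨ cong ((c ⁻¹ ∙ a x) ∙_) (sym (⁻¹-involutive c)) ⟩
      conj (c ⁻¹) (a x)          ≡⟨ sym (app-tabulate _ x) ⟩
      app G (tabulate (conj (c ⁻¹) ∘ a)) x ∎

  weaklyEquivalent⇔sameOrbit : ∀ Ω Ω' → WeaklyEquivalent G Ω Ω' ⇔ SameOrbit Aut Ω Ω'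
  weaklyEquivalent⇔sameOrbit Ω Ω' = mk⇔
    (λ (f , f-iso , a , A , f-equivariant) →
      tabulate (conj (f ε ⁻¹) ∘ a) , aut-tabulate (aut-∘ (conj-isAutomorphism (f ε ⁻¹)) A) ,
      equivariantIso⇒image f-iso A f-equivariant)
    image⇒weaklyEquivalent

  equivalent⇔sameOrbit : ∀ Ω Ω' → Equivalent G Ω Ω' ⇔ SameOrbit Inn Ω Ω'
  equivalent⇔sameOrbit Ω Ω' = mk⇔
    (λ (f , f-iso , f-equivariant) →
      tabulate (conj (f ε ⁻¹)) , (aut-tabulate (conj-isAutomorphism (f ε ⁻¹)) , f ε ⁻¹ , app-tabulate _) ,
      equivariantIso⇒image f-iso id-isAutomorphism f-equivariant)
    image⇒equivalent

ClassCount-⇔ : {A : Set} {P : A → Set} {R R' : A → A → Set} → (∀ x y → R x y ⇔ R' x y) →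
               ∀ {m} → ClassCount P R m → ClassCount P R' m
ClassCount-⇔ R⇔R' (reps , reps-P , reps-distinct , reps-cover) =
  reps , reps-P ,
  (λ i j → reps-distinct i j ∘ Equivalence.from (R⇔R' _ _)) ,
  (λ x Px → let i , Rx = reps-cover x Px in i , Equivalence.to (R⇔R' _ _) Rx)

module _ {n : ℕ} (G : FinGroup n) (2≤n : 2 ≤ n) {μ : Subset n → ℤ} (μ-isMobius : IsMobius G μ) where

  formulaHolds : (Γ : AutomorphismSubgroup G) {R : Subset n → Subset n → Set} →
                 (∀ Ω Ω' → R Ω Ω' ⇔ SameOrbit G Γ Ω Ω') →
                 FormulaHolds G μ R (AutomorphismSubgroup.elements Γ)
  formulaHolds Γ {R} R⇔orbit = counts , vanishes
    where
    open AutomorphismSubgroup Γ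
    -- The identity holds for every k.
    counts : ∀ k → 1 ≤ k → k < n → ∀ a → ClassCount (IsConnectionSet G k) R a →
             + length elements * + a ≡ sumCoeff G μ elements k
    counts k _ _ a classes = trans
      (orbit-counting G Γ (connectionSet? G k) (λ {α} α∈ → connectionSet-image G α (automorphism α∈)) a
        (ClassCount-⇔ R⇔orbit classes))
      (sym (sumCoeff≡#fixedConnectionSets G μ-isMobius elements k))
    vanishes : ∀ k → (k ≡ 0 → sumCoeff G μ elements k ≡ + 0) × (n ≤ k → sumCoeff G μ elements k ≡ + 0)
    vanishes k =
      (λ { refl → sumCoeff-vanishes G μ-isMobius elements 0 (λ _ → connectionSet-size≢0 G 2≤n) }) ,
      (λ n≤k → sumCoeff-vanishes G μ-isMobius elements k
                 (λ _ Ω-conn → ℕ.<⇒≱ (connectionSet-size< G Ω-conn) n≤k))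

theorem2p5 : {n : ℕ} (G : FinGroup n) → 2 ≤ n →
    (μ : Subset n → ℤ) → IsMobius G μ →
    FormulaHolds G μ (WeaklyEquivalent G) (autList G)
      × FormulaHolds G μ (Equivalent G) (innList G)
theorem2p5 G 2≤n μ μ-isMobius =
  formulaHolds G 2≤n μ-isMobius (Aut G) (weaklyEquivalent⇔sameOrbit G) ,
  formulaHolds G 2≤n μ-isMobius (Inn G) (equivalent⇔sameOrbit G)
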